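{- Let $\bar\Gamma$ be a connected undirected simple graph that contains an induced subgraph isomorphic to $E_6^{(1)}$ or to $E_7^{(1)}$. Then $\bar\Gamma$ is not BM-equivalent to any Dynkin graph.
   Context: $E_6^{(1)}$ is the tree with one branch vertex and three arms of length $2$ (7 vertices). $E_7^{(1)}$ is the tree with one branch vertex and arms of lengths $3,3,1$ (8 vertices). Basic move: for adjacent vertices $a,c$, $\phi_{c,a}$ toggles adjacency between $c$ and every vertex $x\ne c$ adjacent to $a$, leaving other edges unchanged. BM-equivalence is generated by basic moves. Dynkin graphs are the trees $A_n$ (path), $D_n$ (path with two leaves at one end), $E_6,E_7,E_8$, which have a branch vertex with arms of lengths $(1,2,2),(1,2,3),(1,2,4)$. -}

module Defs where

open import Data.Bool using (Bool; true; false; _∧_; _∨_; _xor_; not)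
open import Data.Nat as ℕ using (ℕ; zero; suc; _≤_; _∸_; _+_)
open import Data.Fin using (Fin; toℕ)
open import Data.Fin.Properties using () renaming (_≟_ to _≟ᶠ_)
open import Data.List using (List; []; _∷_; _++_; upTo; map)
open import Data.Bool.ListAction using (any)
open import Data.Product using (Σ; ∃; ∃-syntax; _×_; _,_)
open import Data.Sum using (_⊎_)
open import Relation.Nullary.Decidable using (⌊_⌋)
open import Relation.Binary.PropositionalEquality using (_≡_)
open import Relation.Binary.Construct.Closure.ReflexiveTransitive using (Star)
open import Function.Bundles using (_↔_; Inverse)
open import Function.Definitions using (Injective)

Adj : ℕ → Set
Adj n = Fin n → Fin n → Bool

IsSimple : {n : ℕ} → Adj n → Set
IsSimple {n} G = (∀ x y → G x y ≡ G y x) × (∀ x → G x x ≡ false)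

Connected : {n : ℕ} → Adj n → Set
Connected {n} G = ∀ (u v : Fin n) → Star (λ x y → G x y ≡ true) u v

-- Basic move φ_{c,a}: toggle adjacency between c and every vertex x ≠ c
-- adjacent to a; all other edges unchanged.
φ : {n : ℕ} → Fin n → Fin n → Adj n → Adj n
φ c a G x y =
  G x y xor ((⌊ x ≟ᶠ c ⌋ ∧ not ⌊ y ≟ᶠ c ⌋ ∧ G a y)
           ∨ (⌊ y ≟ᶠ c ⌋ ∧ not ⌊ x ≟ᶠ c ⌋ ∧ G a x))

BasicMove : {n : ℕ} → Adj n → Adj n → Set
BasicMove {n} G G' =
  Σ (Fin n) λ a → Σ (Fin n) λ c →
    (G a c ≡ true) × (∀ x y → G' x y ≡ φ c a G x y)

-- BM-equivalence: generated by basic moves (reflexive-transitive closure;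
-- basic moves are involutions, so this is already symmetric).
BMEquiv : {n : ℕ} → Adj n → Adj n → Set
BMEquiv = Star BasicMove

fromEdges : {n : ℕ} → List (ℕ × ℕ) → Adj n
fromEdges es x y = any (λ { (i , j) →
  (⌊ toℕ x ℕ.≟ i ⌋ ∧ ⌊ toℕ y ℕ.≟ j ⌋) ∨ (⌊ toℕ x ℕ.≟ j ⌋ ∧ ⌊ toℕ y ℕ.≟ i ⌋) }) es

pathEdges : ℕ → List (ℕ × ℕ)
pathEdges m = map (λ k → (k , suc k)) (upTo m)

A-graph : (n : ℕ) → Adj n
A-graph n = fromEdges (pathEdges (n ∸ 1))

D-graph : (n : ℕ) → Adj n
D-graph n = fromEdges (pathEdges (n ∸ 2) ++ ((n ∸ 3 , n ∸ 1) ∷ []))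

-- E_n (n = 6,7,8): path 0 - ... - (n-2), plus leaf n-1 attached to 2;
-- branch vertex 2 with arms of lengths 1, 2, n-4.
E-graph : (n : ℕ) → Adj n
E-graph n = fromEdges (pathEdges (n ∸ 2) ++ ((2 , n ∸ 1) ∷ []))

E6aff : Adj 7
E6aff = fromEdges ((0 , 1) ∷ (1 , 2) ∷ (0 , 3) ∷ (3 , 4) ∷ (0 , 5) ∷ (5 , 6) ∷ [])

E7aff : Adj 8
E7aff = fromEdges ((0 , 1) ∷ (1 , 2) ∷ (2 , 3) ∷ (0 , 4) ∷ (4 , 5) ∷ (5 , 6) ∷ (0 , 7) ∷ [])

Isomorphic : {n : ℕ} → Adj n → Adj n → Set
Isomorphic {n} G H =
  Σ (Fin n ↔ Fin n) λ σ → ∀ i j → G (Inverse.to σ i) (Inverse.to σ j) ≡ H i j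

HasInducedSubgraph : {n m : ℕ} → Adj n → Adj m → Set
HasInducedSubgraph {n} {m} G H =
  Σ (Fin m → Fin n) λ f → Injective _≡_ _≡_ f × (∀ i j → G (f i) (f j) ≡ H i j)

IsDynkin : {n : ℕ} → Adj n → Set
IsDynkin {n} G =
    (1 ≤ n × Isomorphic G (A-graph n))
  ⊎ (4 ≤ n × Isomorphic G (D-graph n))
  ⊎ ((n ≡ 6 ⊎ n ≡ 7 ⊎ n ≡ 8) × Isomorphic G (E-graph n))

-- Call a graph positive if it has a positive definite quasi-Cartan companion: a
-- symmetric integer matrix with 2 on the diagonal, ±1 at the edges and 0 elsewhere.
-- Positivity is reflected by basic moves: if φ_{c,a} takes G to G′ and M is a positive
-- companion of G′, then conjugating M by the transvection I − M_ac·E_ca gives a positive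
-- companion of G, because the only entries that could go wrong, ±2, are excluded by
-- positivity. Dynkin graphs are positive, since their Cartan matrices are: for A_n and
-- D_n by induction on attaching a leaf, for E₈ by an explicit sum of squares, and E₆, E₇
-- are induced subgraphs of E₈. Positivity passes to induced subgraphs, but E₆⁽¹⁾ and
-- E₇⁽¹⁾ are not positive: a companion of a tree is switched by signs into the Cartan
-- matrix, for which the imaginary root δ of an affine diagram is isotropic.

module Submission where

open import Defs
open import Data.Nat as ℕ using (ℕ; zero; suc; z≤n; s≤s)
open import Data.Fin as Fin using (Fin; zero; suc; toℕ; punchIn)
open import Data.Fin.Patterns using (0F; 1F; 2F; 3F; 4F; 5F; 6F; 7F)
open import Data.Fin.Properties using (_≟_; all?; _<?_; punchIn-injective)
open import Data.Integer as ℤ using (ℤ; +_; -[1+_]; 0ℤ; 1ℤ; -1ℤ; _+_; _*_; -_; _-_; _≤_; _<_; +≤+)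
import Data.Integer.Properties as ℤ
open import Data.Integer.Tactic.RingSolver using (solve-∀)
open import Algebra.Properties.Semiring.Sum ℤ.+-*-semiring
  using (sum; sum-cong-≗; sum-replicate-zero; ∑-comm; ∑-distrib-+; *-distribˡ-sum; *-distribʳ-sum)
open import Data.Vec.Functional using (Vector)
open import Data.Vec using (Vec; []; _∷_; lookup)
open import Data.Bool using (Bool; true; false; _∧_; _∨_; _xor_; if_then_else_)
import Data.Bool.Properties as Bool
open import Data.Bool.Properties using (∧-comm; ∨-comm; ∧-zeroʳ; ∨-identityʳ; xor-identityʳ)
open import Data.List using (List; []; _∷_; _++_; map; applyUpTo)
open import Data.List.Properties using (map-++)
open import Data.Product using (_×_; _,_; ∃; proj₁; proj₂)
open import Data.Sum using (_⊎_; inj₁; inj₂)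
open import Data.Empty using (⊥)
open import Function.Base using (_∘_; id)
open import Function.Bundles using (Inverse)
open import Function.Definitions using (Injective)
open import Relation.Nullary using (¬_; Dec; yes; no; contradiction; ¬?)
open import Relation.Nullary.Decidable using (⌊_⌋; map′; isYes≗does; from-yes; _×-dec_; _⊎-dec_; _→-dec_)
open import Relation.Binary.PropositionalEquality
open import Relation.Binary.Construct.Closure.ReflexiveTransitive using (ε; _◅_)
open ≡-Reasoning

private
  variable
    m n : ℕ

-- Quadratic forms over ℤ

Matrix : ℕ → Set
Matrix n = Fin n → Fin n → ℤ

infix 7 _·_ _*ᵥ_

_·_ : Vector ℤ n → Vector ℤ n → ℤ
x · y = sum (λ i → x i * y i)

_*ᵥ_ : (Fin m → Fin n → ℤ) → Vector ℤ n → Vector ℤ m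
(L *ᵥ y) k = L k · y

Q : Matrix n → Vector ℤ n → ℤ
Q M x = x · (M *ᵥ x)

Symmetric : Matrix n → Set
Symmetric M = ∀ i j → M i j ≡ M j i

PositiveDefinite : Matrix n → Set
PositiveDefinite M = ∀ x → Q M x ≤ 0ℤ → ∀ i → x i ≡ 0ℤ

sum-zero : {f : Vector ℤ n} → (∀ i → f i ≡ 0ℤ) → sum f ≡ 0ℤ
sum-zero {n} f≗0 = trans (sum-cong-≗ f≗0) (sum-replicate-zero n)

·-comm : (x y : Vector ℤ n) → x · y ≡ y · x
·-comm x y = sum-cong-≗ λ i → ℤ.*-comm (x i) (y i)

·-congʳ : (x : Vector ℤ n) {y z : Vector ℤ n} → (∀ i → y i ≡ z i) → x · y ≡ x · z
·-congʳ x y≗z = sum-cong-≗ λ i → cong (x i *_) (y≗z i)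

Q-congˡ : ∀ {M N : Matrix n} x → (∀ i j → M i j ≡ N i j) → Q M x ≡ Q N x
Q-congˡ x M≗N = ·-congʳ x λ i → sum-cong-≗ λ j → cong (_* x j) (M≗N i j)

Q-congʳ : (M : Matrix n) {x y : Vector ℤ n} → (∀ i → x i ≡ y i) → Q M x ≡ Q M y
Q-congʳ M x≗y = sum-cong-≗ λ i → cong₂ _*_ (x≗y i) (sum-cong-≗ λ j → cong (M i j *_) (x≗y j))

positive-cong : ∀ {M N : Matrix n} → (∀ i j → M i j ≡ N i j) →
                PositiveDefinite N → PositiveDefinite M
positive-cong M≗N pd x Q≤0 = pd x (subst (_≤ 0ℤ) (Q-congˡ x M≗N) Q≤0)

Q-scale : (c : ℤ) (M : Matrix n) (x : Vector ℤ n) → Q (λ i j → c * M i j) x ≡ c * Q M x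
Q-scale c M x = begin
  sum (λ i → x i * sum (λ j → c * M i j * x j))
    ≡⟨ sum-cong-≗ (λ i → cong (x i *_) (sum-cong-≗ λ j → ℤ.*-assoc c (M i j) (x j))) ⟩
  sum (λ i → x i * sum (λ j → c * (M i j * x j)))
    ≡⟨ sum-cong-≗ (λ i → cong (x i *_) (*-distribˡ-sum c (λ j → M i j * x j))) ⟨
  sum (λ i → x i * (c * (M *ᵥ x) i))
    ≡⟨ sum-cong-≗ (λ i → swap (x i) c ((M *ᵥ x) i)) ⟩
  sum (λ i → c * (x i * (M *ᵥ x) i))
    ≡⟨ *-distribˡ-sum c (λ i → x i * (M *ᵥ x) i) ⟨
  c * Q M x ∎
  where
  swap : ∀ a b c → a * (b * c) ≡ b * (a * c)
  swap = solve-∀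

Q-switch : (σ : Vector ℤ n) (M : Matrix n) (z : Vector ℤ n) →
           Q M (λ i → σ i * z i) ≡ Q (λ i j → σ i * M i j * σ j) z
Q-switch σ M z = sum-cong-≗ λ i → begin
  σ i * z i * sum (λ j → M i j * (σ j * z j))
    ≡⟨ swap (σ i) (z i) _ ⟩
  z i * (σ i * sum (λ j → M i j * (σ j * z j)))
    ≡⟨ cong (z i *_) (*-distribˡ-sum (σ i) (λ j → M i j * (σ j * z j))) ⟩
  z i * sum (λ j → σ i * (M i j * (σ j * z j)))
    ≡⟨ cong (z i *_) (sum-cong-≗ λ j → regroup (σ i) (M i j) (σ j) (z j)) ⟩
  z i * sum (λ j → σ i * M i j * σ j * z j) ∎
  where
  swap : ∀ s z t → s * z * t ≡ z * (s * t)
  swap = solve-∀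
  regroup : ∀ s m t z → s * (m * (t * z)) ≡ s * m * t * z
  regroup = solve-∀

δ : Fin n → Fin n → ℤ
δ zero    zero    = 1ℤ
δ zero    (suc _) = 0ℤ
δ (suc _) zero    = 0ℤ
δ (suc i) (suc j) = δ i j

δ-diag : (i : Fin n) → δ i i ≡ 1ℤ
δ-diag zero    = refl
δ-diag (suc i) = δ-diag i

δ-apart : {i j : Fin n} → i ≢ j → δ i j ≡ 0ℤ
δ-apart {i = zero}  {zero}  i≢j = contradiction refl i≢j
δ-apart {i = zero}  {suc j} _   = refl
δ-apart {i = suc i} {zero}  _   = refl
δ-apart {i = suc i} {suc j} i≢j = δ-apart (i≢j ∘ cong suc)

δ-sym : (i j : Fin n) → δ i j ≡ δ j i
δ-sym zero    zero    = refl
δ-sym zero    (suc j) = refl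
δ-sym (suc i) zero    = refl
δ-sym (suc i) (suc j) = δ-sym i j

δ-injective : {f : Fin m → Fin n} → Injective _≡_ _≡_ f → ∀ i j → δ (f i) (f j) ≡ δ i j
δ-injective {f = f} f-inj i j with i ≟ j
... | yes refl = trans (δ-diag (f i)) (sym (δ-diag i))
... | no i≢j   = trans (δ-apart (i≢j ∘ f-inj)) (sym (δ-apart i≢j))

∑-δ : (i : Fin n) (g : Vector ℤ n) → sum (λ j → δ i j * g j) ≡ g i
∑-δ zero g = begin
  1ℤ * g zero + sum (λ j → 0ℤ * g (suc j))
    ≡⟨ cong₂ _+_ (ℤ.*-identityˡ (g zero)) (sum-zero (ℤ.*-zeroˡ ∘ g ∘ suc)) ⟩
  g zero + 0ℤ
    ≡⟨ ℤ.+-identityʳ (g zero) ⟩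
  g zero ∎
∑-δ (suc i) g = begin
  0ℤ * g zero + sum (λ j → δ i j * g (suc j)) ≡⟨ cong₂ _+_ (ℤ.*-zeroˡ (g zero)) (∑-δ i (g ∘ suc)) ⟩
  0ℤ + g (suc i)                              ≡⟨ ℤ.+-identityˡ (g (suc i)) ⟩
  g (suc i)                                   ∎

∑-δʳ : (i : Fin n) (g : Vector ℤ n) → sum (λ j → g j * δ i j) ≡ g i
∑-δʳ i g = trans (sum-cong-≗ λ j → ℤ.*-comm (g j) (δ i j)) (∑-δ i g)

-- In matrix notation combine L x = Lᵀx and congruence L M = L M Lᵀ.
combine : (Fin m → Fin n → ℤ) → Vector ℤ m → Vector ℤ n
combine L x v = sum (λ k → x k * L k v)

combine-adjoint : (L : Fin m → Fin n → ℤ) (x : Vector ℤ m) (y : Vector ℤ n) →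
                  combine L x · y ≡ x · (L *ᵥ y)
combine-adjoint L x y = begin
  sum (λ v → sum (λ k → x k * L k v) * y v)
    ≡⟨ sum-cong-≗ (λ v → *-distribʳ-sum (y v) (λ k → x k * L k v)) ⟩
  sum (λ v → sum (λ k → x k * L k v * y v))
    ≡⟨ ∑-comm (λ v k → x k * L k v * y v) ⟩
  sum (λ k → sum (λ v → x k * L k v * y v))
    ≡⟨ sum-cong-≗ (λ k → sum-cong-≗ λ v → ℤ.*-assoc (x k) (L k v) (y v)) ⟩
  sum (λ k → sum (λ v → x k * (L k v * y v)))
    ≡⟨ sum-cong-≗ (λ k → *-distribˡ-sum (x k) (λ v → L k v * y v)) ⟨
  x · (L *ᵥ y) ∎

congruence : (Fin m → Fin n → ℤ) → Matrix n → Matrix m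
congruence L M k l = L k · (M *ᵥ L l)

Q-congruence : (L : Fin m → Fin n → ℤ) (M : Matrix n) (x : Vector ℤ m) →
               Q M (combine L x) ≡ Q (congruence L M) x
Q-congruence L M x = begin
  combine L x · (M *ᵥ combine L x) ≡⟨ combine-adjoint L x _ ⟩
  x · (L *ᵥ (M *ᵥ combine L x))    ≡⟨ ·-congʳ x row ⟩
  Q (congruence L M) x             ∎
  where
  B : Fin _ → Fin _ → ℤ
  B l = M *ᵥ L l
  M-combine : ∀ u → (M *ᵥ combine L x) u ≡ combine B x u
  M-combine u = begin
    M u · combine L x ≡⟨ ·-comm (M u) _ ⟩
    combine L x · M u ≡⟨ combine-adjoint L x (M u) ⟩
    x · (L *ᵥ M u)    ≡⟨ ·-congʳ x (λ l → ·-comm (L l) (M u)) ⟩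
    combine B x u     ∎
  row : ∀ k → (L *ᵥ (M *ᵥ combine L x)) k ≡ (congruence L M *ᵥ x) k
  row k = begin
    L k · (M *ᵥ combine L x)
      ≡⟨ ·-congʳ (L k) M-combine ⟩
    L k · combine B x
      ≡⟨ ·-comm (L k) _ ⟩
    combine B x · L k
      ≡⟨ combine-adjoint B x (L k) ⟩
    x · (B *ᵥ L k)
      ≡⟨ sum-cong-≗ (λ l → trans (cong (x l *_) (·-comm (B l) (L k))) (ℤ.*-comm (x l) _)) ⟩
    congruence L M k · x ∎

positive-congruence : (L : Fin m → Fin n → ℤ) {M : Matrix n} →
  (∀ x → (∀ v → combine L x v ≡ 0ℤ) → ∀ k → x k ≡ 0ℤ) →
  PositiveDefinite M → PositiveDefinite (congruence L M)
positive-congruence L {M} kernel-trivial pd x Q≤0 =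
  kernel-trivial x (pd (combine L x) (subst (_≤ 0ℤ) (sym (Q-congruence L M x)) Q≤0))

bilinear-symmetric : {M : Matrix n} → Symmetric M → ∀ u v → u · (M *ᵥ v) ≡ v · (M *ᵥ u)
bilinear-symmetric {M = M} symmetric u v = begin
  u · (M *ᵥ v)
    ≡⟨ ·-congʳ u (λ i → sum-cong-≗ λ j → trans (cong (_* v j) (symmetric i j)) (ℤ.*-comm (M j i) (v j))) ⟩
  u · combine M v
    ≡⟨ ·-comm u (combine M v) ⟩
  combine M v · u
    ≡⟨ combine-adjoint M v u ⟩
  v · (M *ᵥ u) ∎

congruence-symmetric : ∀ {m} (L : Fin m → Fin n → ℤ) {M : Matrix n} → Symmetric M → Symmetric (congruence L M)
congruence-symmetric L symmetric k l = bilinear-symmetric symmetric (L k) (L l)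

embedding : (Fin m → Fin n) → Fin m → Fin n → ℤ
embedding f k = δ (f k)

congruence-embedding : (f : Fin m → Fin n) (M : Matrix n) →
                       ∀ k l → M (f k) (f l) ≡ congruence (embedding f) M k l
congruence-embedding f M k l = sym (begin
  δ (f k) · (M *ᵥ δ (f l)) ≡⟨ ∑-δ (f k) (M *ᵥ δ (f l)) ⟩
  M (f k) · δ (f l)        ≡⟨ ·-comm (M (f k)) (δ (f l)) ⟩
  δ (f l) · M (f k)        ≡⟨ ∑-δ (f l) (M (f k)) ⟩
  M (f k) (f l)            ∎)

combine-embedding : {f : Fin m → Fin n} → Injective _≡_ _≡_ f →
                    ∀ x l → combine (embedding f) x (f l) ≡ x l
combine-embedding {f = f} f-inj x l = begin
  sum (λ k → x k * δ (f k) (f l))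
    ≡⟨ sum-cong-≗ (λ k → cong (x k *_) (trans (δ-injective f-inj k l) (δ-sym k l))) ⟩
  sum (λ k → x k * δ l k)
    ≡⟨ ∑-δʳ l x ⟩
  x l ∎

positive-restrict : {f : Fin m → Fin n} {M : Matrix n} → Injective _≡_ _≡_ f →
                    PositiveDefinite M → PositiveDefinite (λ k l → M (f k) (f l))
positive-restrict {f = f} {M} f-inj pd =
  positive-cong (congruence-embedding f M) (positive-congruence (embedding f) {M} kernel-trivial pd)
  where
  kernel-trivial : ∀ x → (∀ v → combine (embedding f) x v ≡ 0ℤ) → ∀ k → x k ≡ 0ℤ
  kernel-trivial x vanishes l = trans (sym (combine-embedding f-inj x l)) (vanishes (f l))

pair : Fin n → Fin n → Fin 2 → Fin n
pair i j 0F = i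
pair i j 1F = j

pair-injective : {i j : Fin n} → i ≢ j → Injective _≡_ _≡_ (pair i j)
pair-injective i≢j {0F} {0F} _   = refl
pair-injective i≢j {0F} {1F} i≡j = contradiction i≡j i≢j
pair-injective i≢j {1F} {0F} j≡i = contradiction (sym j≡i) i≢j
pair-injective i≢j {1F} {1F} _   = refl

-- Q vanishes at eᵢ ∓ eⱼ when Mᵢⱼ = ±2.
off-diagonal-bound : {M : Matrix n} → Symmetric M → (∀ i → M i i ≡ + 2) → PositiveDefinite M →
                     ∀ {i j} → i ≢ j → M i j ≢ + 2 × M i j ≢ - + 2
off-diagonal-bound {M = M} symmetric diagonal pd {i} {j} i≢j =
    (λ Mij≡2  → isotropic -1ℤ (trans (Q-pair -1ℤ) (cong (λ m → + 2 + (m + m) * -1ℤ + + 2) Mij≡2)))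
  , (λ Mij≡-2 → isotropic 1ℤ  (trans (Q-pair 1ℤ)  (cong (λ m → + 2 + (m + m) * 1ℤ  + + 2) Mij≡-2)))
  where
  v : ℤ → Vector ℤ 2
  v t 0F = 1ℤ
  v t 1F = t
  N : Matrix 2
  N k l = M (pair i j k) (pair i j l)
  expand : ∀ a b c d t → 1ℤ * (a * 1ℤ + (b * t + 0ℤ)) + (t * (c * 1ℤ + (d * t + 0ℤ)) + 0ℤ)
                         ≡ a + (b + c) * t + d * (t * t)
  expand = solve-∀
  Q-pair : ∀ t → Q N (v t) ≡ + 2 + (M i j + M i j) * t + + 2 * (t * t)
  Q-pair t = begin
    Q N (v t)
      ≡⟨ expand (M i i) (M i j) (M j i) (M j j) t ⟩
    M i i + (M i j + M j i) * t + M j j * (t * t)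
      ≡⟨ cong₂ (λ a d → a + (M i j + M j i) * t + d * (t * t)) (diagonal i) (diagonal j) ⟩
    + 2 + (M i j + M j i) * t + + 2 * (t * t)
      ≡⟨ cong (λ c → + 2 + (M i j + c) * t + + 2 * (t * t)) (symmetric j i) ⟩
    + 2 + (M i j + M i j) * t + + 2 * (t * t) ∎
  isotropic : ∀ t → Q N (v t) ≡ 0ℤ → ⊥
  isotropic t Q≡0 with positive-restrict {M = M} (pair-injective i≢j) pd (v t) (ℤ.≤-reflexive Q≡0) 0F
  ... | ()

-- Transvections

-- elementary c a s = I + s·E_ca, so the transvection adds s times row and column a to
-- row and column c.
elementary : Fin n → Fin n → ℤ → Fin n → Fin n → ℤ
elementary c a s k u = δ k u + s * δ c k * δ a u

∑-elementary : ∀ (c a : Fin n) s k (g : Vector ℤ n) →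
               sum (λ u → elementary c a s k u * g u) ≡ g k + s * δ c k * g a
∑-elementary c a s k g = begin
  sum (λ u → (δ k u + s * δ c k * δ a u) * g u)
    ≡⟨ sum-cong-≗ (λ u → split (δ k u) (s * δ c k) (δ a u) (g u)) ⟩
  sum (λ u → δ k u * g u + s * δ c k * (δ a u * g u))
    ≡⟨ ∑-distrib-+ (λ u → δ k u * g u) (λ u → s * δ c k * (δ a u * g u)) ⟩
  sum (λ u → δ k u * g u) + sum (λ u → s * δ c k * (δ a u * g u))
    ≡⟨ cong₂ _+_ (∑-δ k g) (sym (*-distribˡ-sum (s * δ c k) (λ u → δ a u * g u))) ⟩
  g k + s * δ c k * sum (λ u → δ a u * g u)
    ≡⟨ cong (λ t → g k + s * δ c k * t) (∑-δ a g) ⟩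
  g k + s * δ c k * g a ∎
  where
  split : ∀ d t e x → (d + t * e) * x ≡ d * x + t * (e * x)
  split = solve-∀

transvection : Matrix n → Fin n → Fin n → ℤ → Matrix n
transvection M c a s = congruence (elementary c a s) M

transvection-entry : ∀ (M : Matrix n) c a s k l →
  transvection M c a s k l ≡ M k l + s * δ c l * M k a + s * δ c k * (M a l + s * δ c l * M a a)
transvection-entry M c a s k l = begin
  elementary c a s k · (M *ᵥ elementary c a s l)
    ≡⟨ ∑-elementary c a s k _ ⟩
  column k + s * δ c k * column a
    ≡⟨ cong₂ (λ p q → p + s * δ c k * q) (column-entry k) (column-entry a) ⟩
  M k l + s * δ c l * M k a + s * δ c k * (M a l + s * δ c l * M a a) ∎
  where
  column : Vector ℤ _
  column = M *ᵥ elementary c a s l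
  column-entry : ∀ u → column u ≡ M u l + s * δ c l * M u a
  column-entry u = trans (·-comm (M u) (elementary c a s l)) (∑-elementary c a s l (M u))

combine-elementary : ∀ (c a : Fin n) s x v → combine (elementary c a s) x v ≡ x v + s * x c * δ a v
combine-elementary c a s x v = begin
  sum (λ k → x k * (δ k v + s * δ c k * δ a v))
    ≡⟨ sum-cong-≗ (λ k → split (x k) (δ k v) s (δ c k) (δ a v)) ⟩
  sum (λ k → x k * δ k v + s * δ a v * (δ c k * x k))
    ≡⟨ ∑-distrib-+ (λ k → x k * δ k v) (λ k → s * δ a v * (δ c k * x k)) ⟩
  sum (λ k → x k * δ k v) + sum (λ k → s * δ a v * (δ c k * x k))
    ≡⟨ cong₂ _+_ (trans (sum-cong-≗ λ k → cong (x k *_) (δ-sym k v)) (∑-δʳ v x))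
                 (sym (*-distribˡ-sum (s * δ a v) (λ k → δ c k * x k))) ⟩
  x v + s * δ a v * sum (λ k → δ c k * x k)
    ≡⟨ cong (λ t → x v + s * δ a v * t) (∑-δ c x) ⟩
  x v + s * δ a v * x c
    ≡⟨ cong (λ t → x v + t) (swap s (δ a v) (x c)) ⟩
  x v + s * x c * δ a v ∎
  where
  split : ∀ p d s e f → p * (d + s * e * f) ≡ p * d + s * f * (e * p)
  split = solve-∀
  swap : ∀ s d p → s * d * p ≡ s * p * d
  swap = solve-∀

positive-transvection : ∀ {M : Matrix n} {c a} s → a ≢ c → PositiveDefinite M →
                        PositiveDefinite (transvection M c a s)
positive-transvection {M = M} {c} {a} s a≢c = positive-congruence (elementary c a s) {M} kernel-trivial
  where
  kernel-trivial : ∀ x → (∀ v → combine (elementary c a s) x v ≡ 0ℤ) → ∀ k → x k ≡ 0ℤ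
  kernel-trivial x vanishes k = begin
    x k                            ≡⟨ ℤ.+-identityʳ (x k) ⟨
    x k + 0ℤ                       ≡⟨ cong (λ t → x k + t) shift-vanishes ⟨
    x k + s * x c * δ a k          ≡⟨ combine-elementary c a s x k ⟨
    combine (elementary c a s) x k ≡⟨ vanishes k ⟩
    0ℤ                             ∎
    where
    x-c≡0 : x c ≡ 0ℤ
    x-c≡0 = begin
      x c
        ≡⟨ ℤ.+-identityʳ (x c) ⟨
      x c + 0ℤ
        ≡⟨ cong (λ t → x c + t) (trans (cong (s * x c *_) (δ-apart a≢c)) (ℤ.*-zeroʳ (s * x c))) ⟨
      x c + s * x c * δ a c
        ≡⟨ combine-elementary c a s x c ⟨
      combine (elementary c a s) x c
        ≡⟨ vanishes c ⟩
      0ℤ ∎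
    shift-vanishes : s * x c * δ a k ≡ 0ℤ
    shift-vanishes = begin
      s * x c * δ a k ≡⟨ cong (λ t → s * t * δ a k) x-c≡0 ⟩
      s * 0ℤ * δ a k  ≡⟨ cong (_* δ a k) (ℤ.*-zeroʳ s) ⟩
      0ℤ * δ a k      ≡⟨ ℤ.*-zeroˡ (δ a k) ⟩
      0ℤ              ∎

-- Sums of squares

square-nonNeg : ∀ a → 0ℤ ≤ a * a
square-nonNeg (+ n)    = subst (0ℤ ≤_) (sym (ℤ.+◃n≡+n (n ℕ.* n))) (+≤+ z≤n)
square-nonNeg -[1+ n ] = +≤+ z≤n

square-zero : ∀ a → a * a ≤ 0ℤ → a ≡ 0ℤ
square-zero a a²≤0 with ℤ.i*j≡0⇒i≡0∨j≡0 a (ℤ.≤-antisym a²≤0 (square-nonNeg a))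
... | inj₁ a≡0 = a≡0
... | inj₂ a≡0 = a≡0

sum-nonNeg : {f : Vector ℤ n} → (∀ k → 0ℤ ≤ f k) → 0ℤ ≤ sum f
sum-nonNeg {zero}  _   = ℤ.≤-refl
sum-nonNeg {suc n} f≥0 = ℤ.+-mono-≤ (f≥0 zero) (sum-nonNeg (f≥0 ∘ suc))

+-nonNeg-≤0 : ∀ {a b} → 0ℤ ≤ a → 0ℤ ≤ b → a + b ≤ 0ℤ → a ≤ 0ℤ × b ≤ 0ℤ
+-nonNeg-≤0 {a} {b} a≥0 b≥0 a+b≤0 =
    ℤ.≤-trans (subst (_≤ a + b) (ℤ.+-identityʳ a) (ℤ.+-monoʳ-≤ a b≥0)) a+b≤0
  , ℤ.≤-trans (subst (_≤ a + b) (ℤ.+-identityˡ b) (ℤ.+-monoˡ-≤ b a≥0)) a+b≤0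

sum-nonNeg-zero : {f : Vector ℤ n} → (∀ k → 0ℤ ≤ f k) → sum f ≤ 0ℤ → ∀ k → f k ≡ 0ℤ
sum-nonNeg-zero {suc n} {f} f≥0 Σ≤0 = λ
  { zero    → ℤ.≤-antisym (proj₁ split) (f≥0 zero)
  ; (suc k) → sum-nonNeg-zero (f≥0 ∘ suc) (proj₂ split) k }
  where
  split : f zero ≤ 0ℤ × sum (f ∘ suc) ≤ 0ℤ
  split = +-nonNeg-≤0 (f≥0 zero) (sum-nonNeg (f≥0 ∘ suc)) Σ≤0

diagonalMatrix : Vector ℤ n → Matrix n
diagonalMatrix w i j = w i * δ i j

Q-diagonalMatrix : (w y : Vector ℤ n) → Q (diagonalMatrix w) y ≡ sum (λ k → w k * (y k * y k))
Q-diagonalMatrix w y = sum-cong-≗ λ k → begin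
  y k * sum (λ j → w k * δ k j * y j)   ≡⟨ cong (y k *_) (sum-cong-≗ λ j → ℤ.*-assoc (w k) (δ k j) (y j)) ⟩
  y k * sum (λ j → w k * (δ k j * y j)) ≡⟨ cong (y k *_) (*-distribˡ-sum (w k) (λ j → δ k j * y j)) ⟨
  y k * (w k * sum (λ j → δ k j * y j)) ≡⟨ cong (λ t → y k * (w k * t)) (∑-δ k y) ⟩
  y k * (w k * y k)                     ≡⟨ rearrange (y k) (w k) ⟩
  w k * (y k * y k)                     ∎
  where
  rearrange : ∀ y w → y * (w * y) ≡ w * (y * y)
  rearrange = solve-∀

transpose : (Fin m → Fin n → ℤ) → Fin n → Fin m → ℤ
transpose L i k = L k i

gram : Vector ℤ m → (Fin m → Fin n → ℤ) → Matrix n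
gram w L = congruence (transpose L) (diagonalMatrix w)

Q-gram : (w : Vector ℤ m) (L : Fin m → Fin n → ℤ) (x : Vector ℤ n) →
         Q (gram w L) x ≡ sum (λ k → w k * ((L *ᵥ x) k * (L *ᵥ x) k))
Q-gram w L x = begin
  Q (gram w L) x                                 ≡⟨ Q-congruence (transpose L) (diagonalMatrix w) x ⟨
  Q (diagonalMatrix w) (combine (transpose L) x) ≡⟨ Q-congʳ (diagonalMatrix w) (λ k → ·-comm x (L k)) ⟩
  Q (diagonalMatrix w) (L *ᵥ x)                  ≡⟨ Q-diagonalMatrix w (L *ᵥ x) ⟩
  sum (λ k → w k * ((L *ᵥ x) k * (L *ᵥ x) k))    ∎

LowerTriangular : Matrix n → Set
LowerTriangular L = ∀ i j → i Fin.< j → L i j ≡ 0ℤ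

triangular-first-row : (L : Matrix (suc n)) → LowerTriangular L → ∀ x → (L *ᵥ x) zero ≡ L zero zero * x zero
triangular-first-row L lower x = begin
  L zero zero * x zero + sum (λ j → L zero (suc j) * x (suc j))
    ≡⟨ cong (λ t → L zero zero * x zero + t)
            (sum-zero λ j → trans (cong (_* x (suc j)) (lower zero (suc j) ℕ.z<s)) (ℤ.*-zeroˡ (x (suc j)))) ⟩
  L zero zero * x zero + 0ℤ
    ≡⟨ ℤ.+-identityʳ (L zero zero * x zero) ⟩
  L zero zero * x zero ∎

triangular-kernel : (L : Matrix n) → LowerTriangular L → (∀ i → L i i ≢ 0ℤ) →
                    ∀ x → (∀ k → (L *ᵥ x) k ≡ 0ℤ) → ∀ i → x i ≡ 0ℤ
triangular-kernel {suc n} L lower nonzero x Lx≡0 = λ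
  { zero    → x₀≡0
  ; (suc i) → triangular-kernel L′ (λ k l k<l → lower (suc k) (suc l) (ℕ.s<s k<l)) (nonzero ∘ suc)
                                (x ∘ suc) tail-kernel i }
  where
  x₀≡0 : x zero ≡ 0ℤ
  x₀≡0 with ℤ.i*j≡0⇒i≡0∨j≡0 (L zero zero) (trans (sym (triangular-first-row L lower x)) (Lx≡0 zero))
  ... | inj₁ L₀₀≡0 = contradiction L₀₀≡0 (nonzero zero)
  ... | inj₂ x₀≡0  = x₀≡0
  L′ : Matrix n
  L′ k l = L (suc k) (suc l)
  tail-kernel : ∀ k → (L′ *ᵥ (x ∘ suc)) k ≡ 0ℤ
  tail-kernel k = begin
    (L′ *ᵥ (x ∘ suc)) k
      ≡⟨ ℤ.+-identityˡ _ ⟨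
    0ℤ + (L′ *ᵥ (x ∘ suc)) k
      ≡⟨ cong (_+ (L′ *ᵥ (x ∘ suc)) k) (trans (cong (L (suc k) zero *_) x₀≡0) (ℤ.*-zeroʳ (L (suc k) zero))) ⟨
    L (suc k) zero * x zero + (L′ *ᵥ (x ∘ suc)) k
      ≡⟨ Lx≡0 (suc k) ⟩
    0ℤ ∎

-- c·M = Lᵀ·diag(w)·L with c and w positive and L invertible: a certificate of positive
-- definiteness that can be checked by evaluation.
record SumOfSquares (M : Matrix n) (c : ℤ) (w : Vector ℤ n) (L : Matrix n) : Set where
  constructor sumOfSquares
  field
    scale-positive   : 0ℤ < c
    weights-positive : ∀ k → 0ℤ < w k
    lower-triangular : LowerTriangular L
    diagonal-nonzero : ∀ i → L i i ≢ 0ℤ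
    gram-identity    : ∀ i j → c * M i j ≡ gram w L i j

sumOfSquares? : (M : Matrix n) (c : ℤ) (w : Vector ℤ n) (L : Matrix n) → Dec (SumOfSquares M c w L)
sumOfSquares? M c w L = map′ (λ (p , q , r , s , t) → sumOfSquares p q r s t)
                             (λ { (sumOfSquares p q r s t) → p , q , r , s , t })
  (0ℤ ℤ.<? c ×-dec all? (λ k → 0ℤ ℤ.<? w k) ×-dec all? (λ i → all? λ j → (i <? j) →-dec (L i j ℤ.≟ 0ℤ))
   ×-dec all? (λ i → ¬? (L i i ℤ.≟ 0ℤ)) ×-dec all? (λ i → all? λ j → c * M i j ℤ.≟ gram w L i j))

module _ {M : Matrix n} {c w L} (sos : SumOfSquares M c w L) where
  open SumOfSquares sos

  scaled-form : ∀ x → c * Q M x ≡ sum (λ k → w k * ((L *ᵥ x) k * (L *ᵥ x) k))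
  scaled-form x = begin
    c * Q M x               ≡⟨ Q-scale c M x ⟨
    Q (λ i j → c * M i j) x ≡⟨ Q-congˡ x gram-identity ⟩
    Q (gram w L) x          ≡⟨ Q-gram w L x ⟩
    sum (λ k → w k * ((L *ᵥ x) k * (L *ᵥ x) k)) ∎

  weighted-square-nonNeg : ∀ k t → 0ℤ ≤ w k * (t * t)
  weighted-square-nonNeg k t = subst (_≤ w k * (t * t)) (ℤ.*-zeroʳ (w k))
    (ℤ.*-monoˡ-≤-nonNeg (w k) {{ℤ.nonNegative (ℤ.<⇒≤ (weights-positive k))}} (square-nonNeg t))

  sumOfSquares-positive : PositiveDefinite M
  sumOfSquares-positive x Q≤0 = triangular-kernel L lower-triangular diagonal-nonzero x row-vanishes
    where
    y : Vector ℤ _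
    y = L *ᵥ x
    Σ≤0 : sum (λ k → w k * (y k * y k)) ≤ 0ℤ
    Σ≤0 = subst (_≤ 0ℤ) (scaled-form x)
      (ℤ.≤-trans (ℤ.*-monoˡ-≤-nonNeg c {{ℤ.nonNegative (ℤ.<⇒≤ scale-positive)}} Q≤0) (ℤ.≤-reflexive (ℤ.*-zeroʳ c)))
    row-vanishes : ∀ k → y k ≡ 0ℤ
    row-vanishes k with ℤ.i*j≡0⇒i≡0∨j≡0 (w k) (sum-nonNeg-zero (λ k → weighted-square-nonNeg k (y k)) Σ≤0 k)
    ... | inj₁ w≡0  = contradiction (sym w≡0) (ℤ.<⇒≢ (weights-positive k))
    ... | inj₂ y²≡0 = square-zero (y k) (ℤ.≤-reflexive y²≡0)

-- Quasi-Cartan companions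

Unit : ℤ → Set
Unit z = z ≡ 1ℤ ⊎ z ≡ -1ℤ

EdgeEntry : Bool → ℤ → Set
EdgeEntry false z = z ≡ 0ℤ
EdgeEntry true  z = Unit z

unit-* : ∀ {p q} → Unit p → Unit q → Unit (p * q)
unit-* (inj₁ refl) (inj₁ refl) = inj₁ refl
unit-* (inj₁ refl) (inj₂ refl) = inj₂ refl
unit-* (inj₂ refl) (inj₁ refl) = inj₂ refl
unit-* (inj₂ refl) (inj₂ refl) = inj₁ refl

unit-neg : ∀ {p} → Unit p → Unit (- p)
unit-neg (inj₁ refl) = inj₂ refl
unit-neg (inj₂ refl) = inj₁ refl

unit-+ : ∀ {p q} → Unit p → Unit q → p + q ≢ + 2 → p + q ≢ - + 2 → p + q ≡ 0ℤ
unit-+ (inj₁ refl) (inj₁ refl) ≢2 _   = contradiction refl ≢2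
unit-+ (inj₁ refl) (inj₂ refl) _  _   = refl
unit-+ (inj₂ refl) (inj₁ refl) _  _   = refl
unit-+ (inj₂ refl) (inj₂ refl) _  ≢-2 = contradiction refl ≢-2

unit-square : ∀ {s} → Unit s → s * + 2 * s ≡ + 2
unit-square (inj₁ refl) = refl
unit-square (inj₂ refl) = refl

unit-switch : ∀ {m s} → Unit m → Unit s → s * m * - (m * s) ≡ -1ℤ
unit-switch (inj₁ refl) (inj₁ refl) = refl
unit-switch (inj₁ refl) (inj₂ refl) = refl
unit-switch (inj₂ refl) (inj₁ refl) = refl
unit-switch (inj₂ refl) (inj₂ refl) = refl

unit-switch′ : ∀ {m s} → Unit m → Unit s → - (m * s) * m * s ≡ -1ℤ
unit-switch′ (inj₁ refl) (inj₁ refl) = refl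
unit-switch′ (inj₁ refl) (inj₂ refl) = refl
unit-switch′ (inj₂ refl) (inj₁ refl) = refl
unit-switch′ (inj₂ refl) (inj₂ refl) = refl

unit-cancel : ∀ {s} t → Unit s → s * t ≡ 0ℤ → t ≡ 0ℤ
unit-cancel {s} t s-unit st≡0 with ℤ.i*j≡0⇒i≡0∨j≡0 s st≡0 | s-unit
... | inj₂ t≡0 | _         = t≡0
... | inj₁ refl | inj₁ ()
... | inj₁ refl | inj₂ ()

record IsQuasiCartan (G : Adj n) (M : Matrix n) : Set where
  field
    symmetric    : Symmetric M
    diagonal     : ∀ i → M i i ≡ + 2
    loopless     : ∀ i → G i i ≡ false
    off-diagonal : ∀ {i j} → i ≢ j → EdgeEntry (G i j) (M i j)

HasPositiveCompanion : Adj n → Set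
HasPositiveCompanion {n} G = ∃ λ (M : Matrix n) → IsQuasiCartan G M × PositiveDefinite M

entry-bit : ∀ {b b′ z} → EdgeEntry b z → EdgeEntry b′ z → b ≡ b′
entry-bit {false} {false} _ _ = refl
entry-bit {false} {true}  refl (inj₁ ())
entry-bit {false} {true}  refl (inj₂ ())
entry-bit {true}  {false} (inj₁ ()) refl
entry-bit {true}  {false} (inj₂ ()) refl
entry-bit {true}  {true}  _ _ = refl

companion-symmetric : ∀ {G : Adj n} {M} → IsQuasiCartan G M → ∀ i j → G i j ≡ G j i
companion-symmetric {G = G} {M} qc i j with i ≟ j
... | yes refl = refl
... | no i≢j   = entry-bit (off-diagonal i≢j) (subst (EdgeEntry (G j i)) (symmetric j i) (off-diagonal (i≢j ∘ sym)))
  where open IsQuasiCartan qc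

induced-positive : ∀ {G : Adj n} {H : Adj m} → HasInducedSubgraph G H →
                   HasPositiveCompanion G → HasPositiveCompanion H
induced-positive {G = G} {H} (f , f-inj , G∘f≡H) (M , qc , pd) =
  (λ k l → M (f k) (f l)) , restricted , positive-restrict {M = M} f-inj pd
  where
  open IsQuasiCartan qc
  restricted : IsQuasiCartan H (λ k l → M (f k) (f l))
  restricted = record
    { symmetric    = λ k l → symmetric (f k) (f l)
    ; diagonal     = diagonal ∘ f
    ; loopless     = λ k → trans (sym (G∘f≡H k k)) (loopless (f k))
    ; off-diagonal = λ {k} {l} k≢l → subst (λ b → EdgeEntry b (M (f k) (f l))) (G∘f≡H k l) (off-diagonal (k≢l ∘ f-inj))
    }

isomorphic⇒induced : {Δ H : Adj n} → Isomorphic Δ H → HasInducedSubgraph H Δ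
isomorphic⇒induced {Δ = Δ} {H} (σ , Δ∘σ≡H) = from , from-injective , H∘from≡Δ
  where
  open Inverse σ
  from-injective : Injective _≡_ _≡_ from
  from-injective {i} {j} eq = trans (sym (strictlyInverseˡ i)) (trans (cong to eq) (strictlyInverseˡ j))
  H∘from≡Δ : ∀ i j → H (from i) (from j) ≡ Δ i j
  H∘from≡Δ i j = trans (sym (Δ∘σ≡H (from i) (from j))) (cong₂ Δ (strictlyInverseˡ i) (strictlyInverseˡ j))

isomorphic-positive : {Δ H : Adj n} → Isomorphic Δ H → HasPositiveCompanion H → HasPositiveCompanion Δ
isomorphic-positive Δ≅H = induced-positive (isomorphic⇒induced Δ≅H)

-- Basic moves

φ-apart : {G : Adj n} {a c x y : Fin n} → x ≢ c → y ≢ c → φ c a G x y ≡ G x y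
φ-apart {G = G} {c = c} {x} {y} x≢c y≢c with x ≟ c | y ≟ c
... | yes x≡c | _       = contradiction x≡c x≢c
... | no _    | yes y≡c = contradiction y≡c y≢c
... | no _    | no _    = xor-identityʳ (G x y)

φ-row : {G : Adj n} {a c y : Fin n} → y ≢ c → φ c a G c y ≡ G c y xor G a y
φ-row {G = G} {a} {c} {y} y≢c with c ≟ c | y ≟ c
... | no c≢c | _       = contradiction refl c≢c
... | yes _  | yes y≡c = contradiction y≡c y≢c
... | yes _  | no _    = cong (G c y xor_) (∨-identityʳ (G a y))

φ-col : {G : Adj n} {a c x : Fin n} → x ≢ c → φ c a G x c ≡ G x c xor G a x
φ-col {c = c} {x = x} x≢c with x ≟ c | c ≟ c
... | yes x≡c | _       = contradiction x≡c x≢c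
... | no _    | no c≢c  = contradiction refl c≢c
... | no _    | yes _   = refl

φ-diag : {G : Adj n} {a c : Fin n} → φ c a G c c ≡ G c c
φ-diag {G = G} {c = c} with c ≟ c
... | no c≢c = contradiction refl c≢c
... | yes _  = xor-identityʳ (G c c)

xor-move : ∀ {p q r} → p ≡ q xor r → q ≡ p xor r
xor-move {q = false} {false} refl = refl
xor-move {q = false} {true}  refl = refl
xor-move {q = true}  {false} refl = refl
xor-move {q = true}  {true}  refl = refl

entry-xor : ∀ {b b′ s m m′} → Unit s → EdgeEntry b m → EdgeEntry b′ m′ →
            m + s * m′ ≢ + 2 → m + s * m′ ≢ - + 2 → EdgeEntry (b xor b′) (m + s * m′)
entry-xor {false} {false} {s} _ refl refl _ _ = trans (ℤ.+-identityˡ (s * 0ℤ)) (ℤ.*-zeroʳ s)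
entry-xor {false} {true}  {s} {m′ = m′} s-unit refl m′-unit _ _ =
  subst Unit (sym (ℤ.+-identityˡ (s * m′))) (unit-* s-unit m′-unit)
entry-xor {true}  {false} {s} {m} _ m-unit refl _ _ =
  subst Unit (sym (trans (cong (λ t → m + t) (ℤ.*-zeroʳ s)) (ℤ.+-identityʳ m))) m-unit
entry-xor {true}  {true} s-unit m-unit m′-unit ≢2 ≢-2 = unit-+ m-unit (unit-* s-unit m′-unit) ≢2 ≢-2

-- With s = −M a c the transvection T has T c c = 2, agrees with M off row and column c,
-- and T c y = M c y + s·M a y, matching G c y = G′ c y xor G′ a y unless it is ±2.
module BasicMoveReflection {G G′ : Adj n} {a c : Fin n} (Gac : G a c ≡ true)
  (G′≡φ : ∀ x y → G′ x y ≡ φ c a G x y) {M : Matrix n} (qc : IsQuasiCartan G′ M)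
  (pd : PositiveDefinite M) where

  open IsQuasiCartan qc

  G-cc : G c c ≡ false
  G-cc = trans (sym (trans (G′≡φ c c) (φ-diag {G = G} {a = a}))) (loopless c)

  a≢c : a ≢ c
  a≢c refl with trans (sym Gac) G-cc
  ... | ()

  G-apart : ∀ {x y} → x ≢ c → y ≢ c → G x y ≡ G′ x y
  G-apart {x} {y} x≢c y≢c = sym (trans (G′≡φ x y) (φ-apart {G = G} {a = a} x≢c y≢c))

  G′-a : ∀ y → G′ a y ≡ G a y
  G′-a y with y ≟ c
  ... | no y≢c   = sym (G-apart a≢c y≢c)
  ... | yes refl = begin
    G′ a c              ≡⟨ trans (G′≡φ a c) (φ-col {G = G} a≢c) ⟩
    G a c xor G a a     ≡⟨ cong (G a c xor_) (trans (G-apart a≢c a≢c) (loopless a)) ⟩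
    G a c xor false     ≡⟨ xor-identityʳ (G a c) ⟩
    G a c               ∎

  G-row : ∀ {y} → y ≢ c → G c y ≡ G′ c y xor G′ a y
  G-row {y} y≢c = trans (xor-move (trans (G′≡φ c y) (φ-row {G = G} y≢c))) (cong (G′ c y xor_) (sym (G′-a y)))

  G-transpose : ∀ {x} → x ≢ c → G x c ≡ G c x
  G-transpose {x} x≢c = begin
    G x c                ≡⟨ xor-move (trans (G′≡φ x c) (φ-col {G = G} x≢c)) ⟩
    G′ x c xor G a x     ≡⟨ cong₂ _xor_ (companion-symmetric qc x c) (sym (G′-a x)) ⟩
    G′ c x xor G′ a x    ≡⟨ G-row x≢c ⟨
    G c x                ∎

  s : ℤ
  s = - M a c

  T : Matrix n
  T = transvection M c a s

  T-apart : ∀ {x y} → x ≢ c → y ≢ c → T x y ≡ M x y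
  T-apart {x} {y} x≢c y≢c = begin
    T x y ≡⟨ transvection-entry M c a s x y ⟩
    M x y + s * δ c y * M x a + s * δ c x * (M a y + s * δ c y * M a a)
      ≡⟨ cong₂ (λ d e → M x y + s * d * M x a + s * e * (M a y + s * d * M a a))
               (δ-apart (y≢c ∘ sym)) (δ-apart (x≢c ∘ sym)) ⟩
    M x y + s * 0ℤ * M x a + s * 0ℤ * (M a y + s * 0ℤ * M a a) ≡⟨ vanish (M x y) s (M x a) (M a y) (M a a) ⟩
    M x y ∎
    where
    vanish : ∀ p s q r t → p + s * 0ℤ * q + s * 0ℤ * (r + s * 0ℤ * t) ≡ p
    vanish = solve-∀

  T-row : ∀ {y} → y ≢ c → T c y ≡ M c y + s * M a y
  T-row {y} y≢c = begin
    T c y ≡⟨ transvection-entry M c a s c y ⟩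
    M c y + s * δ c y * M c a + s * δ c c * (M a y + s * δ c y * M a a)
      ≡⟨ cong₂ (λ d e → M c y + s * d * M c a + s * e * (M a y + s * d * M a a)) (δ-apart (y≢c ∘ sym)) (δ-diag c) ⟩
    M c y + s * 0ℤ * M c a + s * 1ℤ * (M a y + s * 0ℤ * M a a) ≡⟨ simplify (M c y) s (M c a) (M a y) (M a a) ⟩
    M c y + s * M a y ∎
    where
    simplify : ∀ p s q r t → p + s * 0ℤ * q + s * 1ℤ * (r + s * 0ℤ * t) ≡ p + s * r
    simplify = solve-∀

  T-cc : T c c ≡ + 2
  T-cc = begin
    T c c ≡⟨ transvection-entry M c a s c c ⟩
    M c c + s * δ c c * M c a + s * δ c c * (M a c + s * δ c c * M a a)
      ≡⟨ cong (λ d → M c c + s * d * M c a + s * d * (M a c + s * d * M a a)) (δ-diag c) ⟩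
    M c c + s * 1ℤ * M c a + s * 1ℤ * (M a c + s * 1ℤ * M a a)
      ≡⟨ cong₂ (λ p q → p + s * 1ℤ * M c a + s * 1ℤ * (M a c + s * 1ℤ * q)) (diagonal c) (diagonal a) ⟩
    + 2 + s * 1ℤ * M c a + s * 1ℤ * (M a c + s * 1ℤ * + 2)
      ≡⟨ cong (λ m → + 2 + s * 1ℤ * m + s * 1ℤ * (M a c + s * 1ℤ * + 2)) (symmetric c a) ⟩
    + 2 + - M a c * 1ℤ * M a c + - M a c * 1ℤ * (M a c + - M a c * 1ℤ * + 2)
      ≡⟨ cancel (M a c) ⟩
    + 2 ∎
    where
    cancel : ∀ m → + 2 + - m * 1ℤ * m + - m * 1ℤ * (m + - m * 1ℤ * + 2) ≡ + 2
    cancel = solve-∀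

  T-symmetric : Symmetric T
  T-symmetric = congruence-symmetric (elementary c a s) symmetric

  T-diagonal : ∀ x → T x x ≡ + 2
  T-diagonal x with x ≟ c
  ... | yes refl = T-cc
  ... | no x≢c   = trans (T-apart x≢c x≢c) (diagonal x)

  T-positive : PositiveDefinite T
  T-positive = positive-transvection {M = M} s a≢c pd

  M-ac-unit : Unit (M a c)
  M-ac-unit = subst (λ b → EdgeEntry b (M a c)) (trans (G′-a c) Gac) (off-diagonal a≢c)

  G-ca : G c a ≡ true
  G-ca = begin
    G c a              ≡⟨ G-row a≢c ⟩
    G′ c a xor G′ a a  ≡⟨ cong₂ _xor_ (companion-symmetric qc c a) (loopless a) ⟩
    G′ a c xor false   ≡⟨ xor-identityʳ (G′ a c) ⟩
    G′ a c             ≡⟨ G′-a c ⟩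
    G a c              ≡⟨ Gac ⟩
    true               ∎

  T-ca : T c a ≡ - M a c
  T-ca = begin
    T c a                   ≡⟨ T-row a≢c ⟩
    M c a + s * M a a       ≡⟨ cong₂ (λ p q → p + s * q) (symmetric c a) (diagonal a) ⟩
    M a c + - M a c * + 2   ≡⟨ cancel (M a c) ⟩
    - M a c                 ∎
    where
    cancel : ∀ m → m + - m * + 2 ≡ - m
    cancel = solve-∀

  T-row-entry : ∀ {y} → y ≢ c → EdgeEntry (G c y) (T c y)
  T-row-entry {y} y≢c with y ≟ a
  ... | yes refl = subst₂ EdgeEntry (sym G-ca) (sym T-ca) (unit-neg M-ac-unit)
  ... | no y≢a   = subst₂ EdgeEntry (sym (G-row y≢c)) (sym (T-row y≢c))
                     (entry-xor (unit-neg M-ac-unit) (off-diagonal (y≢c ∘ sym)) (off-diagonal (y≢a ∘ sym))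
                       (proj₁ bound ∘ trans (T-row y≢c)) (proj₂ bound ∘ trans (T-row y≢c)))
    where
    bound : T c y ≢ + 2 × T c y ≢ - + 2
    bound = off-diagonal-bound T-symmetric T-diagonal T-positive (y≢c ∘ sym)

  T-off-diagonal : ∀ {x y} → x ≢ y → EdgeEntry (G x y) (T x y)
  T-off-diagonal {x} {y} x≢y with x ≟ c | y ≟ c
  ... | yes refl | yes refl = contradiction refl x≢y
  ... | yes refl | no y≢c   = T-row-entry y≢c
  ... | no x≢c   | yes refl = subst₂ EdgeEntry (sym (G-transpose x≢c)) (T-symmetric c x) (T-row-entry x≢c)
  ... | no x≢c   | no y≢c   = subst₂ EdgeEntry (sym (G-apart x≢c y≢c)) (sym (T-apart x≢c y≢c)) (off-diagonal x≢y)

  T-quasiCartan : IsQuasiCartan G T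
  T-quasiCartan = record
    { symmetric    = T-symmetric
    ; diagonal     = T-diagonal
    ; loopless     = G-loopless
    ; off-diagonal = T-off-diagonal
    }
    where
    G-loopless : ∀ x → G x x ≡ false
    G-loopless x with x ≟ c
    ... | yes refl = G-cc
    ... | no x≢c   = trans (G-apart x≢c x≢c) (loopless x)

positive-reflects-move : {G G′ : Adj n} → BasicMove G G′ → HasPositiveCompanion G′ → HasPositiveCompanion G
positive-reflects-move {G = G} {G′} (a , c , Gac , G′≡φ) (M , qc , pd) = T , T-quasiCartan , T-positive
  where open BasicMoveReflection {G = G} {G′} {a} {c} Gac G′≡φ qc pd

positive-reflects-BM : {G Δ : Adj n} → BMEquiv G Δ → HasPositiveCompanion Δ → HasPositiveCompanion G
positive-reflects-BM ε            = λ positive → positive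
positive-reflects-BM (move ◅ moves) = positive-reflects-move move ∘ positive-reflects-BM moves

-- Dynkin graphs

adjacency : Adj n → Matrix n
adjacency G i j = if G i j then 1ℤ else 0ℤ

cartan : Adj n → Matrix n
cartan G i j = + 2 * δ i j - adjacency G i j

cartan-symmetric : {G : Adj n} → (∀ i j → G i j ≡ G j i) → Symmetric (cartan G)
cartan-symmetric G-symmetric i j = cong₂ (λ d b → + 2 * d - (if b then 1ℤ else 0ℤ)) (δ-sym i j) (G-symmetric i j)

cartan-quasiCartan : {G : Adj n} → (∀ i j → G i j ≡ G j i) → (∀ i → G i i ≡ false) →
                     IsQuasiCartan G (cartan G)
cartan-quasiCartan {G = G} G-symmetric G-loopless = record
  { symmetric    = cartan-symmetric G-symmetric
  ; diagonal     = λ i → cong₂ (λ d b → + 2 * d - (if b then 1ℤ else 0ℤ)) (δ-diag i) (G-loopless i)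
  ; loopless     = G-loopless
  ; off-diagonal = λ {i} {j} i≢j →
      subst (λ d → EdgeEntry (G i j) (+ 2 * d - adjacency G i j)) (sym (δ-apart i≢j)) (entry (G i j))
  }
  where
  entry : ∀ b → EdgeEntry b (+ 2 * 0ℤ - (if b then 1ℤ else 0ℤ))
  entry false = refl
  entry true  = inj₂ refl

fromEdges-symmetric : ∀ es (x y : Fin n) → fromEdges es x y ≡ fromEdges es y x
fromEdges-symmetric []            x y = refl
fromEdges-symmetric ((i , j) ∷ es) x y =
  cong₂ _∨_ (mirror ⌊ toℕ x ℕ.≟ i ⌋ ⌊ toℕ y ℕ.≟ j ⌋ ⌊ toℕ x ℕ.≟ j ⌋ ⌊ toℕ y ℕ.≟ i ⌋) (fromEdges-symmetric es x y)
  where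
  mirror : ∀ p q r t → (p ∧ q) ∨ (r ∧ t) ≡ (t ∧ r) ∨ (q ∧ p)
  mirror p q r t = trans (∨-comm (p ∧ q) (r ∧ t)) (cong₂ _∨_ (∧-comm r t) (∧-comm p q))

shift : ℕ × ℕ → ℕ × ℕ
shift (i , j) = suc i , suc j

attachLeaf : List (ℕ × ℕ) → List (ℕ × ℕ)
attachLeaf es = (0 , 1) ∷ map shift es

⌊suc≟suc⌋ : ∀ a b → ⌊ suc a ℕ.≟ suc b ⌋ ≡ ⌊ a ℕ.≟ b ⌋
⌊suc≟suc⌋ a b = trans (isYes≗does (suc a ℕ.≟ suc b)) (sym (isYes≗does (a ℕ.≟ b)))

fromEdges-shift : ∀ es (i j : Fin n) → fromEdges (map shift es) (suc i) (suc j) ≡ fromEdges es i j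
fromEdges-shift []             i j = refl
fromEdges-shift ((a , b) ∷ es) i j = cong₂ _∨_
  (cong₂ _∨_ (cong₂ _∧_ (⌊suc≟suc⌋ (toℕ i) a) (⌊suc≟suc⌋ (toℕ j) b))
             (cong₂ _∧_ (⌊suc≟suc⌋ (toℕ i) b) (⌊suc≟suc⌋ (toℕ j) a)))
  (fromEdges-shift es i j)

fromEdges-shift-root : ∀ es (y : Fin (suc n)) → fromEdges (map shift es) zero y ≡ false
fromEdges-shift-root []       y = refl
fromEdges-shift-root (_ ∷ es) y = fromEdges-shift-root es y

attachLeaf-root : ∀ es → fromEdges {suc (suc n)} (attachLeaf es) 0F 0F ≡ false
attachLeaf-root {n} es = fromEdges-shift-root {suc n} es 0F

attachLeaf-far : ∀ es (j : Fin n) → fromEdges (attachLeaf es) 0F (suc (suc j)) ≡ false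
attachLeaf-far es j = fromEdges-shift-root es (suc (suc j))

attachLeaf-tail : ∀ es (i j : Fin (suc n)) → fromEdges (attachLeaf es) (suc i) (suc j) ≡ fromEdges es i j
attachLeaf-tail es i j = cong₂ _∨_ (∧-zeroʳ ⌊ suc (toℕ i) ℕ.≟ 1 ⌋) (fromEdges-shift es i j)

-- The invariant that survives attaching a leaf at vertex 0 (see extend): completing the
-- square, Q(x) = x₀² + (x₀ − x₁)² + (Q′(x′) − x₁²).
record Extendable (M : Matrix (suc n)) : Set where
  field
    root-bound : ∀ y → y 0F * y 0F ≤ Q M y
    positive   : PositiveDefinite M

extend : {M : Matrix (suc (suc n))} → Symmetric M → M 0F 0F ≡ + 2 → M 0F 1F ≡ -1ℤ →
         (∀ j → M 0F (suc (suc j)) ≡ 0ℤ) → Extendable (λ i j → M (suc i) (suc j)) → Extendable M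
extend {n} {M} symmetric M₀₀ M₀₁ M₀far ext = record { root-bound = root-bound ; positive = positive }
  where
  module E = Extendable ext
  M′ : Matrix (suc n)
  M′ i j = M (suc i) (suc j)

  module _ (x : Vector ℤ (suc (suc n))) where
    x′ : Vector ℤ (suc n)
    x′ = x ∘ suc

    first-row-rest : sum (λ j → M 0F (suc j) * x′ j) ≡ - x 1F
    first-row-rest = begin
      M 0F 1F * x 1F + sum (λ j → M 0F (suc (suc j)) * x (suc (suc j)))
        ≡⟨ cong₂ _+_ (cong (_* x 1F) M₀₁)
                     (sum-zero λ j → trans (cong (_* x (suc (suc j))) (M₀far j)) (ℤ.*-zeroˡ (x (suc (suc j))))) ⟩
      -1ℤ * x 1F + 0ℤ ≡⟨ negate (x 1F) ⟩
      - x 1F          ∎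
      where
      negate : ∀ a → -1ℤ * a + 0ℤ ≡ - a
      negate = solve-∀

    first-column-rest : sum (λ i → x′ i * (M (suc i) 0F * x 0F)) ≡ - x 1F * x 0F
    first-column-rest = begin
      sum (λ i → x′ i * (M (suc i) 0F * x 0F))
        ≡⟨ sum-cong-≗ (λ i → trans (cong (λ m → x′ i * (m * x 0F)) (symmetric (suc i) 0F))
                                   (rearrange (x′ i) (M 0F (suc i)) (x 0F))) ⟩
      sum (λ i → M 0F (suc i) * x′ i * x 0F)
        ≡⟨ *-distribʳ-sum (x 0F) (λ i → M 0F (suc i) * x′ i) ⟨
      sum (λ i → M 0F (suc i) * x′ i) * x 0F
        ≡⟨ cong (_* x 0F) first-row-rest ⟩
      - x 1F * x 0F ∎
      where
      rearrange : ∀ a m b → a * (m * b) ≡ m * a * b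
      rearrange = solve-∀

    peel : Q M x ≡ x 0F * (+ 2 * x 0F - x 1F) + (- x 1F * x 0F + Q M′ x′)
    peel = cong₂ _+_ first-term rest
      where
      first-term : x 0F * (M 0F 0F * x 0F + sum (λ j → M 0F (suc j) * x′ j)) ≡ x 0F * (+ 2 * x 0F - x 1F)
      first-term = cong₂ (λ m r → x 0F * (m * x 0F + r)) M₀₀ first-row-rest
      rest : sum (λ i → x′ i * (M (suc i) 0F * x 0F + (M′ *ᵥ x′) i)) ≡ - x 1F * x 0F + Q M′ x′
      rest = begin
        sum (λ i → x′ i * (M (suc i) 0F * x 0F + (M′ *ᵥ x′) i))
          ≡⟨ sum-cong-≗ (λ i → ℤ.*-distribˡ-+ (x′ i) (M (suc i) 0F * x 0F) ((M′ *ᵥ x′) i)) ⟩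
        sum (λ i → x′ i * (M (suc i) 0F * x 0F) + x′ i * (M′ *ᵥ x′) i)
          ≡⟨ ∑-distrib-+ (λ i → x′ i * (M (suc i) 0F * x 0F)) (λ i → x′ i * (M′ *ᵥ x′) i) ⟩
        sum (λ i → x′ i * (M (suc i) 0F * x 0F)) + Q M′ x′
          ≡⟨ cong (_+ Q M′ x′) first-column-rest ⟩
        - x 1F * x 0F + Q M′ x′ ∎

    squares : Q M x ≡ x 0F * x 0F + ((x 0F - x 1F) * (x 0F - x 1F) + (Q M′ x′ - x 1F * x 1F))
    squares = trans peel (complete (x 0F) (x 1F) (Q M′ x′))
      where
      complete : ∀ a b q → a * (+ 2 * a - b) + (- b * a + q) ≡ a * a + ((a - b) * (a - b) + (q - b * b))
      complete = solve-∀

    root-bound : x 0F * x 0F ≤ Q M x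
    root-bound = subst (x 0F * x 0F ≤_) (sym squares) (ℤ.≤-trans x₀²≤x₀²+0 (ℤ.+-monoʳ-≤ (x 0F * x 0F) rest≥0))
      where
      x₀²≤x₀²+0 : x 0F * x 0F ≤ x 0F * x 0F + 0ℤ
      x₀²≤x₀²+0 = ℤ.≤-reflexive (sym (ℤ.+-identityʳ (x 0F * x 0F)))
      rest≥0 : 0ℤ ≤ (x 0F - x 1F) * (x 0F - x 1F) + (Q M′ x′ - x 1F * x 1F)
      rest≥0 = ℤ.+-mono-≤ (square-nonNeg (x 0F - x 1F)) (ℤ.i≤j⇒0≤j-i (E.root-bound x′))

    positive : Q M x ≤ 0ℤ → ∀ i → x i ≡ 0ℤ
    positive Q≤0 = λ { zero → x₀≡0 ; (suc i) → E.positive x′ Q′≤0 i }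
      where
      x₀≡0 : x 0F ≡ 0ℤ
      x₀≡0 = square-zero (x 0F) (ℤ.≤-trans root-bound Q≤0)
      Q′≤0 : Q M′ x′ ≤ 0ℤ
      Q′≤0 = subst (_≤ 0ℤ) (trans peel (trans (cong (λ a → a * (+ 2 * a - x 1F) + (- x 1F * a + Q M′ x′)) x₀≡0)
                                               (vanish (x 1F) (Q M′ x′)))) Q≤0
        where
        vanish : ∀ b q → 0ℤ * (+ 2 * 0ℤ - b) + (- b * 0ℤ + q) ≡ q
        vanish = solve-∀

Extendable-cong : {M N : Matrix (suc n)} → (∀ i j → M i j ≡ N i j) → Extendable N → Extendable M
Extendable-cong M≗N ext = record
  { root-bound = λ y → subst (y 0F * y 0F ≤_) (sym (Q-congˡ y M≗N)) (E.root-bound y)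
  ; positive   = positive-cong M≗N E.positive
  }
  where module E = Extendable ext

module _ {M : Matrix (suc n)} {c w L} (sos : SumOfSquares M c w L) where

  sumOfSquares-extendable : L 0F 0F ≡ 1ℤ → c ≤ w 0F → Extendable M
  sumOfSquares-extendable L₀₀≡1 c≤w₀ = record
    { root-bound = root-bound ; positive = sumOfSquares-positive sos }
    where
    first-row : ∀ y → (L *ᵥ y) 0F ≡ y 0F
    first-row y = begin
      (L *ᵥ y) 0F    ≡⟨ triangular-first-row L (SumOfSquares.lower-triangular sos) y ⟩
      L 0F 0F * y 0F ≡⟨ cong (_* y 0F) L₀₀≡1 ⟩
      1ℤ * y 0F      ≡⟨ ℤ.*-identityˡ (y 0F) ⟩
      y 0F           ∎
    root-bound : ∀ y → y 0F * y 0F ≤ Q M y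
    root-bound y = ℤ.*-cancelˡ-≤-pos (y 0F * y 0F) (Q M y) c {{ℤ.positive (SumOfSquares.scale-positive sos)}}
      (ℤ.≤-trans (ℤ.*-monoʳ-≤-nonNeg (y 0F * y 0F) {{ℤ.nonNegative (square-nonNeg (y 0F))}} c≤w₀)
                 (subst₂ _≤_ (cong (λ t → w 0F * (t * t)) (first-row y)) (sym (scaled-form sos y)) first-term≤))
      where
      ℓ : Vector ℤ _
      ℓ = L *ᵥ y
      first-term≤ : w 0F * (ℓ 0F * ℓ 0F) ≤ w 0F * (ℓ 0F * ℓ 0F) + sum (λ k → w (suc k) * (ℓ (suc k) * ℓ (suc k)))
      first-term≤ = ℤ.≤-trans (ℤ.≤-reflexive (sym (ℤ.+-identityʳ (w 0F * (ℓ 0F * ℓ 0F)))))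
                    (ℤ.+-monoʳ-≤ (w 0F * (ℓ 0F * ℓ 0F))
                                 (sum-nonNeg λ k → weighted-square-nonNeg sos (suc k) (ℓ (suc k))))

record LeafExtensible (n : ℕ) (es : List (ℕ × ℕ)) : Set where
  field
    loopless   : ∀ i → fromEdges {suc n} es i i ≡ false
    extendable : Extendable (cartan (fromEdges {suc n} es))

attach-extensible : ∀ {es} → LeafExtensible n es → LeafExtensible (suc n) (attachLeaf es)
attach-extensible {n} {es} ext = record { loopless = loopless ; extendable = extendable }
  where
  module X = LeafExtensible ext
  G : Adj (suc (suc n))
  G = fromEdges (attachLeaf es)
  loopless : ∀ i → G i i ≡ false
  loopless zero    = attachLeaf-root {n} es
  loopless (suc i) = trans (attachLeaf-tail es i i) (X.loopless i)
  entry : ∀ i j {b} → G i j ≡ b → cartan G i j ≡ + 2 * δ i j - (if b then 1ℤ else 0ℤ)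
  entry i j = cong (λ b → + 2 * δ i j - (if b then 1ℤ else 0ℤ))
  extendable : Extendable (cartan G)
  extendable = extend (cartan-symmetric (fromEdges-symmetric (attachLeaf es))) (entry 0F 0F (attachLeaf-root {n} es)) refl
                 (λ j → entry 0F (suc (suc j)) (attachLeaf-far es j))
                 (Extendable-cong (λ i j → entry (suc i) (suc j) (attachLeaf-tail es i j)) X.extendable)

extensible-positive : ∀ {es} → LeafExtensible n es → HasPositiveCompanion (fromEdges {suc n} es)
extensible-positive {es = es} ext =
  cartan _ , cartan-quasiCartan (fromEdges-symmetric es) X.loopless , Extendable.positive X.extendable
  where module X = LeafExtensible ext

pathEdges-suc : ∀ m → pathEdges (suc m) ≡ attachLeaf (pathEdges m)
pathEdges-suc m = cong ((0 , 1) ∷_) (shifted id m)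
  where
  shifted : ∀ f m → map (λ k → k , suc k) (applyUpTo (suc ∘ f) m) ≡ map shift (map (λ k → k , suc k) (applyUpTo f m))
  shifted f zero    = refl
  shifted f (suc m) = cong (_ ∷_) (shifted (f ∘ suc) m)

A-extensible : ∀ m → LeafExtensible m (pathEdges m)
A-extensible zero    = record
  { loopless   = λ { 0F → refl }
  ; extendable = sumOfSquares-extendable (from-yes (sumOfSquares? (cartan (A-graph 1)) 1ℤ (λ _ → + 2) (λ _ _ → 1ℤ)))
                                         refl (+≤+ (s≤s z≤n))
  }
A-extensible (suc m) = subst (LeafExtensible (suc m)) (sym (pathEdges-suc m)) (attach-extensible (A-extensible m))

D-extensible : ∀ k → LeafExtensible (suc (suc k)) (pathEdges (suc k) ++ (k , suc (suc k)) ∷ [])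
D-extensible zero    = record
  { loopless   = λ { 0F → refl ; 1F → refl ; 2F → refl }
  ; extendable = sumOfSquares-extendable (from-yes (sumOfSquares? (cartan (D-graph 3)) (+ 2) D₃-weights D₃-rows))
                                         refl ℤ.≤-refl
  }
  where
  -- 2·Q(x) = 2x₀² + (2x₁ − x₀)² + (2x₂ − x₀)², vertex 0 being the branch point of D₃.
  D₃-weights : Vector ℤ 3
  D₃-weights = lookup (+ 2 ∷ 1ℤ ∷ 1ℤ ∷ [])
  D₃-rows : Matrix 3
  D₃-rows i = lookup (lookup table i)
    where
    table : Vec (Vec ℤ 3) 3
    table = (1ℤ  ∷ 0ℤ  ∷ 0ℤ  ∷ [])
          ∷ (-1ℤ ∷ + 2 ∷ 0ℤ  ∷ [])
          ∷ (-1ℤ ∷ 0ℤ  ∷ + 2 ∷ [])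
          ∷ []
D-extensible (suc k) = subst (LeafExtensible (suc (suc (suc k)))) (sym edges) (attach-extensible (D-extensible k))
  where
  edges : pathEdges (suc (suc k)) ++ (suc k , suc (suc (suc k))) ∷ [] ≡ attachLeaf (pathEdges (suc k) ++ (k , suc (suc k)) ∷ [])
  edges = trans (cong (_++ (suc k , suc (suc (suc k))) ∷ []) (pathEdges-suc (suc k)))
                (cong ((0 , 1) ∷_) (sym (map-++ shift (pathEdges (suc k)) ((k , suc (suc k)) ∷ []))))

-- The LDLᵀ decomposition of 420·cartan(E₈), eliminating vertices from the last one,
-- with the rows scaled to integers.
E₈-weights : Vector ℤ 8
E₈-weights = lookup (+ 105 ∷ + 15 ∷ + 6 ∷ + 21 ∷ + 35 ∷ + 70 ∷ + 210 ∷ + 210 ∷ [])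

E₈-rows : Matrix 8
E₈-rows i = lookup (lookup table i)
  where
  table : Vec (Vec ℤ 8) 8
  table = (+ 1   ∷ 0ℤ     ∷ 0ℤ    ∷ 0ℤ    ∷ 0ℤ    ∷ 0ℤ    ∷ 0ℤ  ∷ 0ℤ  ∷ [])
        ∷ (- + 7 ∷ + 4    ∷ 0ℤ    ∷ 0ℤ    ∷ 0ℤ    ∷ 0ℤ    ∷ 0ℤ  ∷ 0ℤ  ∷ [])
        ∷ (0ℤ    ∷ - + 10 ∷ + 7   ∷ 0ℤ    ∷ 0ℤ    ∷ 0ℤ    ∷ 0ℤ  ∷ 0ℤ  ∷ [])
        ∷ (0ℤ    ∷ 0ℤ     ∷ - + 4 ∷ + 5   ∷ 0ℤ    ∷ 0ℤ    ∷ 0ℤ  ∷ 0ℤ  ∷ [])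
        ∷ (0ℤ    ∷ 0ℤ     ∷ 0ℤ    ∷ - + 3 ∷ + 4   ∷ 0ℤ    ∷ 0ℤ  ∷ 0ℤ  ∷ [])
        ∷ (0ℤ    ∷ 0ℤ     ∷ 0ℤ    ∷ 0ℤ    ∷ - + 2 ∷ + 3   ∷ 0ℤ  ∷ 0ℤ  ∷ [])
        ∷ (0ℤ    ∷ 0ℤ     ∷ 0ℤ    ∷ 0ℤ    ∷ 0ℤ    ∷ -1ℤ   ∷ + 2 ∷ 0ℤ  ∷ [])
        ∷ (0ℤ    ∷ 0ℤ     ∷ -1ℤ   ∷ 0ℤ    ∷ 0ℤ    ∷ 0ℤ    ∷ 0ℤ  ∷ + 2 ∷ [])
        ∷ []

E₈-cartan-positive : PositiveDefinite (cartan (E-graph 8))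
E₈-cartan-positive = sumOfSquares-positive (from-yes (sumOfSquares? (cartan (E-graph 8)) (+ 420) E₈-weights E₈-rows))

E₈-positive : HasPositiveCompanion (E-graph 8)
E₈-positive = cartan (E-graph 8)
            , cartan-quasiCartan (fromEdges-symmetric (pathEdges 6 ++ (2 , 7) ∷ []))
                                 (from-yes (all? λ i → E-graph 8 i i Bool.≟ false))
            , E₈-cartan-positive

E₇⊆E₈ : HasInducedSubgraph (E-graph 8) (E-graph 7)
E₇⊆E₈ = punchIn 6F , (λ {i} {j} → punchIn-injective 6F i j)
      , from-yes (all? λ i → all? λ j → E-graph 8 (punchIn 6F i) (punchIn 6F j) Bool.≟ E-graph 7 i j)

E₆⊆E₇ : HasInducedSubgraph (E-graph 7) (E-graph 6)
E₆⊆E₇ = punchIn 5F , (λ {i} {j} → punchIn-injective 5F i j)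
      , from-yes (all? λ i → all? λ j → E-graph 7 (punchIn 5F i) (punchIn 5F j) Bool.≟ E-graph 6 i j)

dynkin-positive : {Δ : Adj n} → IsDynkin Δ → HasPositiveCompanion Δ
dynkin-positive {suc m} (inj₁ (_ , Δ≅A)) = isomorphic-positive Δ≅A (extensible-positive (A-extensible m))
dynkin-positive {suc (suc (suc (suc k)))} (inj₂ (inj₁ (_ , Δ≅D))) =
  isomorphic-positive Δ≅D (extensible-positive (D-extensible (suc k)))
dynkin-positive (inj₂ (inj₂ (inj₁ refl , Δ≅E))) =
  isomorphic-positive Δ≅E (induced-positive E₆⊆E₇ (induced-positive E₇⊆E₈ E₈-positive))
dynkin-positive (inj₂ (inj₂ (inj₂ (inj₁ refl) , Δ≅E))) = isomorphic-positive Δ≅E (induced-positive E₇⊆E₈ E₈-positive)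
dynkin-positive (inj₂ (inj₂ (inj₂ (inj₂ refl) , Δ≅E))) = isomorphic-positive Δ≅E E₈-positive
dynkin-positive {zero} (inj₁ (() , _))
dynkin-positive {suc zero} (inj₂ (inj₁ (s≤s () , _)))
dynkin-positive {suc (suc zero)} (inj₂ (inj₁ (s≤s (s≤s ()) , _)))
dynkin-positive {suc (suc (suc zero))} (inj₂ (inj₁ (s≤s (s≤s (s≤s ())) , _)))

-- Affine graphs

propagate : Matrix n → Fin n → Fin n → ℤ → ℤ
propagate M p v s = - (M p v * s)

propagate-unit : {H : Adj n} {M : Matrix n} → IsQuasiCartan H M →
                 ∀ {p v s} → p ≢ v → H p v ≡ true → Unit s → Unit (propagate M p v s)
propagate-unit {M = M} qc {p} {v} p≢v edge s-unit =
  unit-neg (unit-* (subst (λ b → EdgeEntry b (M p v)) edge (IsQuasiCartan.off-diagonal qc p≢v)) s-unit)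

-- σ switches signs along a spanning tree (every edge joins a vertex to its parent) so that
-- all edge entries of σ M σ become −1, turning M into the Cartan matrix of H.
module Switching {H : Adj n} {M : Matrix n} (qc : IsQuasiCartan H M)
  (parent : Fin n → Fin n) (edge-parent : ∀ i j → H i j ≡ true → parent j ≡ i ⊎ parent i ≡ j)
  (σ : Vector ℤ n) (σ-unit : ∀ v → Unit (σ v))
  (σ-parent : ∀ v → parent v ≢ v → σ v ≡ propagate M (parent v) v (σ (parent v))) where

  open IsQuasiCartan qc

  switched-apart : ∀ {i j} → i ≢ j → σ i * M i j * σ j ≡ - adjacency H i j
  switched-apart {i} {j} i≢j with H i j in Hij | off-diagonal i≢j
  ... | false | Mij≡0 =
    trans (cong (λ m → σ i * m * σ j) Mij≡0) (trans (cong (_* σ j) (ℤ.*-zeroʳ (σ i))) (ℤ.*-zeroˡ (σ j)))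
  ... | true  | Mij-unit with edge-parent i j Hij
  ...   | inj₁ refl =
    trans (cong (σ (parent j) * M (parent j) j *_) (σ-parent j i≢j)) (unit-switch Mij-unit (σ-unit (parent j)))
  ...   | inj₂ refl = begin
    σ i * M i (parent i) * σ (parent i)
      ≡⟨ cong₂ (λ s m → s * m * σ (parent i)) (σ-parent i (i≢j ∘ sym)) (symmetric i (parent i)) ⟩
    - (M (parent i) i * σ (parent i)) * M (parent i) i * σ (parent i)
      ≡⟨ unit-switch′ (subst Unit (symmetric i (parent i)) Mij-unit) (σ-unit (parent i)) ⟩
    -1ℤ ∎

  switched-cartan : ∀ i j → σ i * M i j * σ j ≡ cartan H i j
  switched-cartan i j with i ≟ j
  ... | yes refl = begin
    σ i * M i i * σ i   ≡⟨ cong (λ m → σ i * m * σ i) (diagonal i) ⟩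
    σ i * + 2 * σ i     ≡⟨ unit-square (σ-unit i) ⟩
    + 2                 ≡⟨ cong₂ (λ d b → + 2 * d - (if b then 1ℤ else 0ℤ)) (δ-diag i) (loopless i) ⟨
    cartan H i i        ∎
  ... | no i≢j   = begin
    σ i * M i j * σ j   ≡⟨ switched-apart i≢j ⟩
    - adjacency H i j   ≡⟨ ℤ.+-identityˡ (- adjacency H i j) ⟨
    + 2 * 0ℤ - adjacency H i j ≡⟨ cong (λ d → + 2 * d - adjacency H i j) (δ-apart i≢j) ⟨
    cartan H i j        ∎

  null-vector-obstruction : (z : Vector ℤ n) → Q (cartan H) z ≡ 0ℤ → ∀ r → z r ≢ 0ℤ → ¬ PositiveDefinite M
  null-vector-obstruction z Qz≡0 r z-r≢0 pd = z-r≢0 (unit-cancel (z r) (σ-unit r) (pd (λ i → σ i * z i) Q≤0 r))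
    where
    Q≤0 : Q M (λ i → σ i * z i) ≤ 0ℤ
    Q≤0 = ℤ.≤-reflexive (begin
      Q M (λ i → σ i * z i)               ≡⟨ Q-switch σ M z ⟩
      Q (λ i j → σ i * M i j * σ j) z     ≡⟨ Q-congˡ z switched-cartan ⟩
      Q (cartan H) z                      ≡⟨ Qz≡0 ⟩
      0ℤ                                  ∎)

module _ {M : Matrix 7} (qc : IsQuasiCartan E6aff M) where
  private
    parent : Fin 7 → Fin 7
    parent = lookup (0F ∷ 0F ∷ 1F ∷ 0F ∷ 3F ∷ 0F ∷ 5F ∷ [])

    σ : Vector ℤ 7
    σ 0F = 1ℤ
    σ 1F = propagate M 0F 1F 1ℤ
    σ 2F = propagate M 1F 2F (propagate M 0F 1F 1ℤ)
    σ 3F = propagate M 0F 3F 1ℤ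
    σ 4F = propagate M 3F 4F (propagate M 0F 3F 1ℤ)
    σ 5F = propagate M 0F 5F 1ℤ
    σ 6F = propagate M 5F 6F (propagate M 0F 5F 1ℤ)

    σ-unit : ∀ v → Unit (σ v)
    σ-unit 0F = inj₁ refl
    σ-unit 1F = propagate-unit qc (λ ()) refl (inj₁ refl)
    σ-unit 2F = propagate-unit qc (λ ()) refl (propagate-unit qc (λ ()) refl (inj₁ refl))
    σ-unit 3F = propagate-unit qc (λ ()) refl (inj₁ refl)
    σ-unit 4F = propagate-unit qc (λ ()) refl (propagate-unit qc (λ ()) refl (inj₁ refl))
    σ-unit 5F = propagate-unit qc (λ ()) refl (inj₁ refl)
    σ-unit 6F = propagate-unit qc (λ ()) refl (propagate-unit qc (λ ()) refl (inj₁ refl))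

    σ-parent : ∀ v → parent v ≢ v → σ v ≡ propagate M (parent v) v (σ (parent v))
    σ-parent 0F root = contradiction refl root
    σ-parent 1F _    = refl
    σ-parent 2F _    = refl
    σ-parent 3F _    = refl
    σ-parent 4F _    = refl
    σ-parent 5F _    = refl
    σ-parent 6F _    = refl

    -- the imaginary root of E₆⁽¹⁾
    null-root : Vector ℤ 7
    null-root = lookup (+ 3 ∷ + 2 ∷ 1ℤ ∷ + 2 ∷ 1ℤ ∷ + 2 ∷ 1ℤ ∷ [])

  E₆aff-not-positive : ¬ PositiveDefinite M
  E₆aff-not-positive = Switching.null-vector-obstruction qc parent
    (from-yes (all? λ i → all? λ j → (E6aff i j Bool.≟ true) →-dec (parent j ≟ i ⊎-dec parent i ≟ j)))
    σ σ-unit σ-parent null-root refl 0F (λ ())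

module _ {M : Matrix 8} (qc : IsQuasiCartan E7aff M) where
  private
    parent : Fin 8 → Fin 8
    parent = lookup (0F ∷ 0F ∷ 1F ∷ 2F ∷ 0F ∷ 4F ∷ 5F ∷ 0F ∷ [])

    σ : Vector ℤ 8
    σ 0F = 1ℤ
    σ 1F = propagate M 0F 1F 1ℤ
    σ 2F = propagate M 1F 2F (propagate M 0F 1F 1ℤ)
    σ 3F = propagate M 2F 3F (propagate M 1F 2F (propagate M 0F 1F 1ℤ))
    σ 4F = propagate M 0F 4F 1ℤ
    σ 5F = propagate M 4F 5F (propagate M 0F 4F 1ℤ)
    σ 6F = propagate M 5F 6F (propagate M 4F 5F (propagate M 0F 4F 1ℤ))
    σ 7F = propagate M 0F 7F 1ℤ

    σ-unit : ∀ v → Unit (σ v)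
    σ-unit 0F = inj₁ refl
    σ-unit 1F = propagate-unit qc (λ ()) refl (inj₁ refl)
    σ-unit 2F = propagate-unit qc (λ ()) refl (propagate-unit qc (λ ()) refl (inj₁ refl))
    σ-unit 3F = propagate-unit qc (λ ()) refl (propagate-unit qc (λ ()) refl (propagate-unit qc (λ ()) refl (inj₁ refl)))
    σ-unit 4F = propagate-unit qc (λ ()) refl (inj₁ refl)
    σ-unit 5F = propagate-unit qc (λ ()) refl (propagate-unit qc (λ ()) refl (inj₁ refl))
    σ-unit 6F = propagate-unit qc (λ ()) refl (propagate-unit qc (λ ()) refl (propagate-unit qc (λ ()) refl (inj₁ refl)))
    σ-unit 7F = propagate-unit qc (λ ()) refl (inj₁ refl)

    σ-parent : ∀ v → parent v ≢ v → σ v ≡ propagate M (parent v) v (σ (parent v))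
    σ-parent 0F root = contradiction refl root
    σ-parent 1F _    = refl
    σ-parent 2F _    = refl
    σ-parent 3F _    = refl
    σ-parent 4F _    = refl
    σ-parent 5F _    = refl
    σ-parent 6F _    = refl
    σ-parent 7F _    = refl

    -- the imaginary root of E₇⁽¹⁾
    null-root : Vector ℤ 8
    null-root = lookup (+ 4 ∷ + 3 ∷ + 2 ∷ 1ℤ ∷ + 3 ∷ + 2 ∷ 1ℤ ∷ + 2 ∷ [])

  E₇aff-not-positive : ¬ PositiveDefinite M
  E₇aff-not-positive = Switching.null-vector-obstruction qc parent
    (from-yes (all? λ i → all? λ j → (E7aff i j Bool.≟ true) →-dec (parent j ≟ i ⊎-dec parent i ≟ j)))
    σ σ-unit σ-parent null-root refl 0F (λ ())

affine-not-positive : {G : Adj n} → HasInducedSubgraph G E6aff ⊎ HasInducedSubgraph G E7aff →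
                      ¬ HasPositiveCompanion G
affine-not-positive (inj₁ E₆aff⊆G) positive with induced-positive E₆aff⊆G positive
... | M , qc , pd = E₆aff-not-positive qc pd
affine-not-positive (inj₂ E₇aff⊆G) positive with induced-positive E₇aff⊆G positive
... | M , qc , pd = E₇aff-not-positive qc pd

proposition5p9 : ∀ {n : ℕ} (G : Adj n) → IsSimple G → Connected G →
    (HasInducedSubgraph G E6aff ⊎ HasInducedSubgraph G E7aff) →
    ¬ (∃ λ Δ → BMEquiv G Δ × IsDynkin Δ)
proposition5p9 G _ _ affine (Δ , G∼Δ , dynkin) =
  affine-not-positive affine (positive-reflects-BM G∼Δ (dynkin-positive dynkin))
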